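{- Let $G$ be a finite group of order $n$. The number of subsets $S\subseteq G$ such that $\varphi(S)=S$ for some $\varphi\in\Aut(G)\setminus\{1\}$ is at most $2^{3n/4+(\log_2 n)^2}$. -}

module Defs where

open import Data.Nat using (ℕ; _*_; _+_; _^_; _≤_)
open import Data.Fin using (Fin)
open import Data.Fin.Subset using (Subset; _∈_)
open import Data.Product using (Σ; ∃; _×_)
open import Relation.Binary.PropositionalEquality using (_≡_)
open import Relation.Nullary using (¬_)
open import Function.Definitions using (Bijective; Injective)
open import Algebra.Core using (Op₁; Op₂)
open import Algebra.Structures using (IsGroup)
open import Function.Bundles using (_⇔_)

-- A finite group of order n, presented (up to isomorphism) on the carrier Fin n
-- with propositional equality.
record FinGroup (n : ℕ) : Set where
  field
    _∙_     : Op₂ (Fin n)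
    ε       : Fin n
    _⁻¹     : Op₁ (Fin n)
    isGroup : IsGroup _≡_ _∙_ ε _⁻¹

record IsAutomorphism {n : ℕ} (G : FinGroup n) (φ : Fin n → Fin n) : Set where
  open FinGroup G
  field
    bijective : Bijective _≡_ _≡_ φ
    homo      : ∀ x y → φ (x ∙ y) ≡ φ x ∙ φ y

ImageEq : {n : ℕ} → (Fin n → Fin n) → Subset n → Set
ImageEq {n} φ S = ∀ (y : Fin n) → (y ∈ S ⇔ (∃ λ x → x ∈ S × φ x ≡ y))

FixedByNontrivialAut : {n : ℕ} → FinGroup n → Subset n → Set
FixedByNontrivialAut {n} G S =
  Σ (Fin n → Fin n) λ φ → IsAutomorphism G φ × ¬ (∀ x → φ x ≡ x) × ImageEq φ S

-- "k ≤ 2^(3n/4 + (log₂ n)²)", expressed without reals: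
-- for every rational a = m/d with a ≥ log₂ n (i.e. n^d ≤ 2^m),
-- k ≤ 2^(3n/4 + (m/d)²), i.e. k^(4d²) ≤ 2^(3n d² + 4m²).
-- (Equivalent to the real inequality by continuity of 2^x.)
BoundedBy : ℕ → ℕ → Set
BoundedBy n k = ∀ (m d : ℕ) → 1 ≤ d → n ^ d ≤ 2 ^ m →
  k ^ (4 * (d * d)) ≤ 2 ^ (3 * n * (d * d) + 4 * (m * m))

-- Every group of order n has elements g₁, …, g_r with 2^r ≤ n such that each element
-- is u⁻¹v for subproducts u, v of the gᵢ, so an automorphism is determined by the images
-- of the gᵢ: there are at most n^r ≤ 2^((log₂ n)²) automorphisms. A subset S fixed by an
-- automorphism ψ is a union of ψ-orbits, hence determined by its trace on the local
-- minima of ψ (points whose image and preimages are not smaller, in a fixed order on G).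
-- If ψ ≠ 1, its fixed points form a proper subgroup, of size at most n/2, and ψ maps the
-- unfixed local minima injectively into non-minima; together, #minima ≤ 3n/4. Thus the
-- pair (images of the gᵢ under ψ, trace of S) encodes S injectively by one of
-- n^r · 2^⌊3n/4⌋ values.

module Submission where

open import Defs
open import Level using (Level; 0ℓ)
open import Algebra.Bundles using (Group)
import Algebra.Properties.Group as GroupProperties
open import Data.Bool using (Bool; true; false; if_then_else_)
open import Data.Fin as Fin using (Fin; zero; suc; splitAt; combine; remQuot; inject≤; funToFin; finToFun)
import Data.Fin.Properties as Finₚ
open import Data.Fin.Induction using (<-wellFounded)
open import Data.Fin.Subset using (Subset; _∈_)
open import Data.Fin.Subset.Properties using (anySubset?)
open import Data.Nat using (ℕ; zero; suc; _+_; _*_; _^_; _≤_; _<_; z≤n; s≤s)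
import Data.Nat.Properties as ℕₚ
open import Data.Nat.DivMod using (_/_; m/n*n≤m; m*n/n≡m; /-monoˡ-≤)
open import Data.Nat.Tactic.RingSolver using (solve-∀)
open import Algebra.Properties.CommutativeSemigroup ℕₚ.+-commutativeSemigroup using (interchange)
open import Data.Product as Product using (∃; ∃₂; _×_; _,_; proj₁; proj₂)
open import Data.Sum using (_⊎_; inj₁; inj₂; [_,_]′)
open import Data.Vec using ([]; _∷_; lookup; tabulate)
open import Data.Vec.Properties using (lookup∘tabulate; tabulate∘lookup; tabulate-cong; lookup⇒[]=; []=⇒lookup)
import Data.Vec.Functional as Vector
open import Function using (_∘_; Inverse; Injection)
open import Function.Bundles using (Equivalence)
open import Function.Definitions using (Injective)
open import Function.Properties.Inverse using (↔⇒↣)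
open import Induction.WellFounded using (Acc; acc)
open import Relation.Binary.PropositionalEquality
open import Relation.Nullary using (¬_; Dec; yes; no; contradiction)
open import Relation.Nullary.Decidable using (¬?; decidable-stable; _×-dec_; _⊎-dec_)
open import Relation.Unary using (Pred; Decidable)

private variable
  a b c : Level
  A : Set a
  k n r : ℕ

indicator : Dec A → ℕ
indicator (yes _) = 1
indicator (no _)  = 0

count : {P : Pred (Fin n) a} → Decidable P → ℕ
count {n = zero}  _  = 0
count {n = suc n} P? = indicator (P? zero) + count (P? ∘ suc)

enumerate : {P : Pred (Fin n) a} (P? : Decidable P) → Fin (count P?) → Fin n
enumerate {n = suc n} P? j with P? zero
enumerate {n = suc n} P? zero    | yes _ = zero
enumerate {n = suc n} P? (suc j) | yes _ = suc (enumerate (P? ∘ suc) j)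
enumerate {n = suc n} P? j       | no _  = suc (enumerate (P? ∘ suc) j)

enumerate-∈ : {P : Pred (Fin n) a} (P? : Decidable P) (j : Fin (count P?)) → P (enumerate P? j)
enumerate-∈ {n = suc n} P? j with P? zero
enumerate-∈ {n = suc n} P? zero    | yes p = p
enumerate-∈ {n = suc n} P? (suc j) | yes _ = enumerate-∈ (P? ∘ suc) j
enumerate-∈ {n = suc n} P? j       | no _  = enumerate-∈ (P? ∘ suc) j

enumerate-injective : {P : Pred (Fin n) a} (P? : Decidable P) → Injective _≡_ _≡_ (enumerate P?)
enumerate-injective {n = suc n} P? {i} {j} eq with P? zero
enumerate-injective {n = suc n} P? {zero}  {zero}  eq | yes _ = refl
enumerate-injective {n = suc n} P? {suc i} {suc j} eq | yes _ =
  cong suc (enumerate-injective (P? ∘ suc) (Finₚ.suc-injective eq))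
enumerate-injective {n = suc n} P? {i}     {j}     eq | no _  =
  enumerate-injective (P? ∘ suc) (Finₚ.suc-injective eq)

enumerate-onto : {P : Pred (Fin n) a} (P? : Decidable P) {x : Fin n} → P x →
  ∃ λ j → enumerate P? j ≡ x
enumerate-onto {n = suc n} P? {x} px with P? zero
enumerate-onto {n = suc n} P? {zero}  px | yes _ = zero , refl
enumerate-onto {n = suc n} P? {suc x} px | yes _ =
  Product.map suc (cong suc) (enumerate-onto (P? ∘ suc) px)
enumerate-onto {n = suc n} P? {zero}  px | no ¬p = contradiction px ¬p
enumerate-onto {n = suc n} P? {suc x} px | no _  =
  Product.map₂ (cong suc) (enumerate-onto (P? ∘ suc) px)

indicator-⊆-⊎ : {B : Set b} {C : Set c} → (A → B ⊎ C) →
  (A? : Dec A) (B? : Dec B) (C? : Dec C) → indicator A? ≤ indicator B? + indicator C?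
indicator-⊆-⊎ _   (no _)  _       _       = z≤n
indicator-⊆-⊎ _   (yes _) (yes _) _       = s≤s z≤n
indicator-⊆-⊎ _   (yes _) (no _)  (yes _) = s≤s z≤n
indicator-⊆-⊎ A⊆B∪C (yes x) (no ¬y) (no ¬z) = contradiction (A⊆B∪C x) [ ¬y , ¬z ]′

count-⊆-∪ : {P : Pred (Fin n) a} {Q : Pred (Fin n) b} {R : Pred (Fin n) c}
  (P? : Decidable P) (Q? : Decidable Q) (R? : Decidable R) →
  (∀ {x} → P x → Q x ⊎ R x) → count P? ≤ count Q? + count R?
count-⊆-∪ {n = zero}  _  _  _  _       = z≤n
count-⊆-∪ {n = suc n} P? Q? R? P⊆Q∪R = begin
  indicator (P? zero) + count (P? ∘ suc)
    ≤⟨ ℕₚ.+-mono-≤ (indicator-⊆-⊎ P⊆Q∪R (P? zero) (Q? zero) (R? zero))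
                   (count-⊆-∪ (P? ∘ suc) (Q? ∘ suc) (R? ∘ suc) P⊆Q∪R) ⟩
  (indicator (Q? zero) + indicator (R? zero)) + (count (Q? ∘ suc) + count (R? ∘ suc))
    ≡⟨ interchange (indicator (Q? zero)) (indicator (R? zero)) (count (Q? ∘ suc)) (count (R? ∘ suc)) ⟩
  (indicator (Q? zero) + count (Q? ∘ suc)) + (indicator (R? zero) + count (R? ∘ suc)) ∎
  where open ℕₚ.≤-Reasoning

count+count≤n : {P : Pred (Fin n) a} {Q : Pred (Fin n) b}
  (P? : Decidable P) (Q? : Decidable Q) {h : Fin n → Fin n} →
  Injective _≡_ _≡_ h → (∀ {x} → P x → ¬ Q (h x)) → count P? + count Q? ≤ n
count+count≤n {n = n} {Q = Q} P? Q? {h} h-injective P⇒¬Qh =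
  Finₚ.injective⇒≤ {f = embed ∘ splitAt (count P?)}
    (Injection.injective (↔⇒↣ Finₚ.+↔⊎) ∘ embed-injective)
  where
  embed : Fin (count P?) ⊎ Fin (count Q?) → Fin n
  embed = [ h ∘ enumerate P? , enumerate Q? ]′

  embed-injective : Injective _≡_ _≡_ embed
  embed-injective {inj₁ i} {inj₁ j} eq = cong inj₁ (enumerate-injective P? (h-injective eq))
  embed-injective {inj₁ i} {inj₂ j} eq =
    contradiction (subst Q (sym eq) (enumerate-∈ Q? j)) (P⇒¬Qh (enumerate-∈ P? i))
  embed-injective {inj₂ i} {inj₁ j} eq =
    contradiction (subst Q eq (enumerate-∈ Q? i)) (P⇒¬Qh (enumerate-∈ P? j))
  embed-injective {inj₂ i} {inj₂ j} eq = cong inj₂ (enumerate-injective Q? eq)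

-- Subsets of Fin r as numbers below 2 ^ r

subsetToFin : Subset r → Fin (2 ^ r)
subsetToFin []      = zero
subsetToFin (b ∷ S) = combine (Inverse.from Finₚ.2↔Bool b) (subsetToFin S)

finToSubset : Fin (2 ^ r) → Subset r
finToSubset {zero}  _ = []
finToSubset {suc r} i =
  Inverse.to Finₚ.2↔Bool (proj₁ (remQuot {2} (2 ^ r) i)) ∷
  finToSubset (proj₂ (remQuot {2} (2 ^ r) i))

finToSubset-subsetToFin : (S : Subset r) → finToSubset (subsetToFin S) ≡ S
finToSubset-subsetToFin []      = refl
finToSubset-subsetToFin {r = suc r} (b ∷ S) = cong₂ _∷_
  (trans (cong (Inverse.to Finₚ.2↔Bool ∘ proj₁) split) (Inverse.strictlyInverseˡ Finₚ.2↔Bool b))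
  (trans (cong (finToSubset ∘ proj₂) split) (finToSubset-subsetToFin S))
  where
  bit : Fin 2
  bit = Inverse.from Finₚ.2↔Bool b
  split : remQuot {2} (2 ^ r) (combine bit (subsetToFin S)) ≡ (bit , subsetToFin S)
  split = Finₚ.remQuot-combine bit (subsetToFin S)

subsetToFin-finToSubset : (i : Fin (2 ^ r)) → subsetToFin (finToSubset {r} i) ≡ i
subsetToFin-finToSubset {zero}  zero = refl
subsetToFin-finToSubset {suc r} i    = trans
  (cong₂ combine (Inverse.strictlyInverseʳ Finₚ.2↔Bool (proj₁ (remQuot {2} (2 ^ r) i)))
                  (subsetToFin-finToSubset {r} (proj₂ (remQuot {2} (2 ^ r) i))))
  (Finₚ.combine-remQuot {2} (2 ^ r) i)

subsetToFin-injective : Injective _≡_ _≡_ (subsetToFin {r})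
subsetToFin-injective {x = S} {S′} eq = begin
  S                             ≡⟨ finToSubset-subsetToFin S ⟨
  finToSubset (subsetToFin S)   ≡⟨ cong finToSubset eq ⟩
  finToSubset (subsetToFin S′)  ≡⟨ finToSubset-subsetToFin S′ ⟩
  S′                            ∎
  where open ≡-Reasoning

finToSubset-injective : Injective _≡_ _≡_ (finToSubset {r})
finToSubset-injective {r = r} {x = i} {j} eq = begin
  i                                ≡⟨ subsetToFin-finToSubset {r} i ⟨
  subsetToFin (finToSubset {r} i)  ≡⟨ cong subsetToFin eq ⟩
  subsetToFin (finToSubset {r} j)  ≡⟨ subsetToFin-finToSubset {r} j ⟩
  j                                ∎
  where open ≡-Reasoning

n<2^n : ∀ n → n < 2 ^ n
n<2^n zero    = s≤s z≤n
n<2^n (suc n) =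
  ℕₚ.+-mono-≤ (ℕₚ.m^n>0 2 n) (ℕₚ.≤-trans (n<2^n n) (ℕₚ.≤-reflexive (sym (ℕₚ.+-identityʳ (2 ^ n)))))

b+a≤n⇒a≤b+c⇒c+c≤n⇒a*4≤3n : ∀ {a b c n} → b + a ≤ n → a ≤ b + c → c + c ≤ n → a * 4 ≤ 3 * n
b+a≤n⇒a≤b+c⇒c+c≤n⇒a*4≤3n {a} {b} {c} {n} b+a≤n a≤b+c c+c≤n = begin
  a * 4                          ≡⟨ split a ⟩
  (a + a) + (a + a)              ≤⟨ ℕₚ.+-monoʳ-≤ (a + a) (ℕₚ.+-mono-≤ a≤b+c a≤b+c) ⟩
  (a + a) + ((b + c) + (b + c))  ≡⟨ regroup a b c ⟩
  ((b + a) + (b + a)) + (c + c)  ≤⟨ ℕₚ.+-mono-≤ (ℕₚ.+-mono-≤ b+a≤n b+a≤n) c+c≤n ⟩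
  (n + n) + n                    ≡⟨ triple n ⟩
  3 * n                          ∎
  where
  open ℕₚ.≤-Reasoning
  split : ∀ a → a * 4 ≡ (a + a) + (a + a)
  split = solve-∀
  regroup : ∀ a b c → (a + a) + ((b + c) + (b + c)) ≡ ((b + a) + (b + a)) + (c + c)
  regroup = solve-∀
  triple : ∀ n → (n + n) + n ≡ 3 * n
  triple = solve-∀

^-distribʳ-* : ∀ a b e → (a * b) ^ e ≡ a ^ e * b ^ e
^-distribʳ-* a b zero    = refl
^-distribʳ-* a b (suc e) =
  trans (cong (a * b *_) (^-distribʳ-* a b e)) (shuffle a b (a ^ e) (b ^ e))
  where
  shuffle : ∀ a b x y → a * b * (x * y) ≡ a * x * (b * y)
  shuffle = solve-∀

2^r≤n⇒r*d≤m : ∀ {n r d m} → 2 ^ r ≤ n → n ^ d ≤ 2 ^ m → r * d ≤ m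
2^r≤n⇒r*d≤m {n} {r} {d} {m} 2^r≤n n^d≤2^m = ℕₚ.≮⇒≥ λ m<r*d →
  ℕₚ.<⇒≱ (ℕₚ.^-monoʳ-< 2 (s≤s (s≤s z≤n)) m<r*d) (begin
    2 ^ (r * d)  ≡⟨ ℕₚ.^-*-assoc 2 r d ⟨
    (2 ^ r) ^ d  ≤⟨ ℕₚ.^-monoˡ-≤ d 2^r≤n ⟩
    n ^ d        ≤⟨ n^d≤2^m ⟩
    2 ^ m        ∎)
  where open ℕₚ.≤-Reasoning

≤n^r*2^c⇒BoundedBy : ∀ {n k r c} → k ≤ n ^ r * 2 ^ c → c * 4 ≤ 3 * n → 2 ^ r ≤ n → BoundedBy n k
≤n^r*2^c⇒BoundedBy {n} {k} {r} {c} k≤n^r*2^c c*4≤3n 2^r≤n m d _ n^d≤2^m = begin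
  k ^ e                                        ≤⟨ ℕₚ.^-monoˡ-≤ e k≤n^r*2^c ⟩
  (n ^ r * 2 ^ c) ^ e                          ≡⟨ ^-distribʳ-* (n ^ r) (2 ^ c) e ⟩
  (n ^ r) ^ e * (2 ^ c) ^ e                    ≤⟨ ℕₚ.*-mono-≤ [n^r]^e≤2^[4m²] [2^c]^e≤2^[3nd²] ⟩
  2 ^ (4 * (m * m)) * 2 ^ (3 * n * (d * d))    ≡⟨ ℕₚ.^-distribˡ-+-* 2 (4 * (m * m)) _ ⟨
  2 ^ (4 * (m * m) + 3 * n * (d * d))          ≡⟨ cong (2 ^_) (ℕₚ.+-comm (4 * (m * m)) _) ⟩
  2 ^ (3 * n * (d * d) + 4 * (m * m))          ∎
  where
  open ℕₚ.≤-Reasoning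
  e : ℕ
  e = 4 * (d * d)

  [n^r]^e≤2^[4m²] : (n ^ r) ^ e ≤ 2 ^ (4 * (m * m))
  [n^r]^e≤2^[4m²] = begin
    (n ^ r) ^ e              ≡⟨ ℕₚ.^-*-assoc n r e ⟩
    n ^ (r * e)              ≡⟨ cong (n ^_) (regroup r d) ⟩
    n ^ (d * (4 * (r * d)))  ≡⟨ ℕₚ.^-*-assoc n d _ ⟨
    (n ^ d) ^ (4 * (r * d))  ≤⟨ ℕₚ.^-monoˡ-≤ (4 * (r * d)) n^d≤2^m ⟩
    (2 ^ m) ^ (4 * (r * d))  ≡⟨ ℕₚ.^-*-assoc 2 m _ ⟩
    2 ^ (m * (4 * (r * d)))  ≤⟨ ℕₚ.^-monoʳ-≤ 2 (ℕₚ.*-monoʳ-≤ m (ℕₚ.*-monoʳ-≤ 4 r*d≤m)) ⟩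
    2 ^ (m * (4 * m))        ≡⟨ cong (2 ^_) (square m) ⟩
    2 ^ (4 * (m * m))        ∎
    where
    r*d≤m : r * d ≤ m
    r*d≤m = 2^r≤n⇒r*d≤m {r = r} {d = d} 2^r≤n n^d≤2^m
    regroup : ∀ r d → r * (4 * (d * d)) ≡ d * (4 * (r * d))
    regroup = solve-∀
    square : ∀ m → m * (4 * m) ≡ 4 * (m * m)
    square = solve-∀

  [2^c]^e≤2^[3nd²] : (2 ^ c) ^ e ≤ 2 ^ (3 * n * (d * d))
  [2^c]^e≤2^[3nd²] = begin
    (2 ^ c) ^ e              ≡⟨ ℕₚ.^-*-assoc 2 c e ⟩
    2 ^ (c * e)              ≡⟨ cong (2 ^_) (regroup c d) ⟩
    2 ^ (c * 4 * (d * d))    ≤⟨ ℕₚ.^-monoʳ-≤ 2 (ℕₚ.*-monoˡ-≤ (d * d) c*4≤3n) ⟩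
    2 ^ (3 * n * (d * d))    ∎
    where
    regroup : ∀ c d → c * (4 * (d * d)) ≡ c * 4 * (d * d)
    regroup = solve-∀

-- Local minima of a self-map of Fin n

module LocalMinima (ψ : Fin n → Fin n) where

  HasSmallerNeighbour : Pred (Fin n) 0ℓ
  HasSmallerNeighbour x = ψ x Fin.< x ⊎ ∃ λ y → ψ y ≡ x × y Fin.< x

  hasSmallerNeighbour? : Decidable HasSmallerNeighbour
  hasSmallerNeighbour? x =
    (ψ x Finₚ.<? x) ⊎-dec Finₚ.any? (λ y → (ψ y Finₚ.≟ x) ×-dec (y Finₚ.<? x))

  LocalMinimum : Pred (Fin n) 0ℓ
  LocalMinimum x = ¬ HasSmallerNeighbour x

  localMinimum? : Decidable LocalMinimum
  localMinimum? = ¬? ∘ hasSmallerNeighbour?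

  Fixed : Pred (Fin n) 0ℓ
  Fixed x = ψ x ≡ x

  fixed? : Decidable Fixed
  fixed? x = ψ x Finₚ.≟ x

  UnfixedLocalMinimum : Pred (Fin n) 0ℓ
  UnfixedLocalMinimum x = LocalMinimum x × ¬ Fixed x

  unfixedLocalMinimum? : Decidable UnfixedLocalMinimum
  unfixedLocalMinimum? x = localMinimum? x ×-dec ¬? (fixed? x)

  Invariant : (Fin n → A) → Set _
  Invariant s = s ∘ ψ ≗ s

  -- Following smaller neighbours from any point reaches a local minimum.
  invariant-≗-on-localMinima : (s t : Fin n → A) → Invariant s → Invariant t →
    (∀ {x} → LocalMinimum x → s x ≡ t x) → s ≗ t
  invariant-≗-on-localMinima s t s-inv t-inv agree x = go x (<-wellFounded x)
    where
    open ≡-Reasoning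
    go : ∀ x → Acc Fin._<_ x → s x ≡ t x
    go x (acc smaller) with localMinimum? x
    ... | yes min  = agree min
    ... | no ¬min with decidable-stable (hasSmallerNeighbour? x) ¬min
    ...   | inj₁ ψx<x = begin
      s x     ≡⟨ s-inv x ⟨
      s (ψ x) ≡⟨ go (ψ x) (smaller ψx<x) ⟩
      t (ψ x) ≡⟨ t-inv x ⟩
      t x     ∎
    ...   | inj₂ (y , refl , y<x) = begin
      s (ψ y) ≡⟨ s-inv y ⟩
      s y     ≡⟨ go y (smaller y<x) ⟩
      t y     ≡⟨ t-inv y ⟨
      t (ψ y) ∎

  unfixedLocalMinimum⇒image-not-localMinimum : ∀ {x} → UnfixedLocalMinimum x → ¬ LocalMinimum (ψ x)
  unfixedLocalMinimum⇒image-not-localMinimum {x} (min , unfixed) ψx-min =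
    ψx-min (inj₂ (x , refl , Finₚ.≤∧≢⇒< (ℕₚ.≮⇒≥ (min ∘ inj₁)) (unfixed ∘ sym)))

  count-localMinima≤unfixed+fixed :
    count localMinimum? ≤ count unfixedLocalMinimum? + count fixed?
  count-localMinima≤unfixed+fixed =
    count-⊆-∪ localMinimum? unfixedLocalMinimum? fixed? (λ {x} → split (fixed? x))
    where
    split : ∀ {x} → Dec (Fixed x) → LocalMinimum x → UnfixedLocalMinimum x ⊎ Fixed x
    split (yes fixed)  _   = inj₂ fixed
    split (no unfixed) min = inj₁ (min , unfixed)

  count-unfixedLocalMinima+count-localMinima≤n : Injective _≡_ _≡_ ψ →
    count unfixedLocalMinimum? + count localMinimum? ≤ n
  count-unfixedLocalMinima+count-localMinima≤n ψ-injective =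
    count+count≤n unfixedLocalMinimum? localMinimum? ψ-injective
      unfixedLocalMinimum⇒image-not-localMinimum

  restrictToLocalMinima : Subset n → Subset (count localMinimum?)
  restrictToLocalMinima S = tabulate (lookup S ∘ enumerate localMinimum?)

  restrictToLocalMinima-injective : ∀ {S S′} → Invariant (lookup S) → Invariant (lookup S′) →
    restrictToLocalMinima S ≡ restrictToLocalMinima S′ → S ≡ S′
  restrictToLocalMinima-injective {S} {S′} S-inv S′-inv eq = begin
    S                     ≡⟨ tabulate∘lookup S ⟨
    tabulate (lookup S)   ≡⟨ tabulate-cong (invariant-≗-on-localMinima _ _ S-inv S′-inv agree) ⟩
    tabulate (lookup S′)  ≡⟨ tabulate∘lookup S′ ⟩
    S′                    ∎
    where
    open ≡-Reasoning
    agree : ∀ {x} → LocalMinimum x → lookup S x ≡ lookup S′ x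
    agree min with j , refl ← enumerate-onto localMinimum? min = begin
      lookup S (enumerate localMinimum? j)   ≡⟨ lookup∘tabulate _ j ⟨
      lookup (restrictToLocalMinima S) j     ≡⟨ cong (λ T → lookup T j) eq ⟩
      lookup (restrictToLocalMinima S′) j    ≡⟨ lookup∘tabulate _ j ⟩
      lookup S′ (enumerate localMinimum? j)  ∎

≡true⇔≡true⇒≡ : ∀ {b b′ : Bool} → (b ≡ true → b′ ≡ true) → (b′ ≡ true → b ≡ true) → b ≡ b′
≡true⇔≡true⇒≡ {false} {false} _ _ = refl
≡true⇔≡true⇒≡ {true}  {true}  _ _ = refl
≡true⇔≡true⇒≡ {true}  {false} ⇒ _ = sym (⇒ refl)
≡true⇔≡true⇒≡ {false} {true}  _ ⇐ = ⇐ refl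

imageEq⇒lookup-invariant : {φ : Fin n → Fin n} {S : Subset n} → Injective _≡_ _≡_ φ →
  ImageEq φ S → LocalMinima.Invariant φ (lookup S)
imageEq⇒lookup-invariant {φ = φ} {S} φ-injective image x = ≡true⇔≡true⇒≡
  ([]=⇒lookup ∘ φx∈S⇒x∈S ∘ lookup⇒[]= (φ x) S)
  ([]=⇒lookup ∘ x∈S⇒φx∈S ∘ lookup⇒[]= x S)
  where
  φx∈S⇒x∈S : φ x ∈ S → x ∈ S
  φx∈S⇒x∈S φx∈S with y , y∈S , φy≡φx ← Equivalence.to (image (φ x)) φx∈S =
    subst (_∈ S) (φ-injective φy≡φx) y∈S

  x∈S⇒φx∈S : x ∈ S → φ x ∈ S
  x∈S⇒φx∈S x∈S = Equivalence.from (image (φ x)) (x , x∈S , refl)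

-- Subproducts in a finite group

asGroup : FinGroup n → Group 0ℓ 0ℓ
asGroup {n} G = record
  { Carrier = Fin n ; _≈_ = _≡_ ; _∙_ = _∙_ ; ε = ε ; _⁻¹ = _⁻¹ ; isGroup = isGroup }
  where open FinGroup G

module FiniteGroup (G : FinGroup n) where

  open FinGroup G
  open Group (asGroup G) using (_\\_; identityˡ; identityʳ; inverseʳ)
  open GroupProperties (asGroup G)
    using (∙-cancelˡ; ∙-cancelʳ; y≈x\\z; identityʳ-unique; inverseʳ-unique)

  Homomorphic : (Fin n → Fin n) → Set
  Homomorphic φ = ∀ x y → φ (x ∙ y) ≡ φ x ∙ φ y

  module _ {φ : Fin n → Fin n} (φ-homo : Homomorphic φ) where

    homo-ε : φ ε ≡ ε
    homo-ε = identityʳ-unique (φ ε) (φ ε) (trans (sym (φ-homo ε ε)) (cong φ (identityˡ ε)))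

    homo-⁻¹ : ∀ x → φ (x ⁻¹) ≡ φ x ⁻¹
    homo-⁻¹ x = inverseʳ-unique (φ x) (φ (x ⁻¹))
      (trans (sym (φ-homo x (x ⁻¹))) (trans (cong φ (inverseʳ x)) homo-ε))

    homo-\\ : ∀ x y → φ (x \\ y) ≡ φ x \\ φ y
    homo-\\ x y = trans (φ-homo (x ⁻¹) y) (cong (_∙ φ y) (homo-⁻¹ x))

  subproduct : (Fin r → Fin n) → Subset r → Fin n
  subproduct gs []      = ε
  subproduct gs (b ∷ I) = subproduct (gs ∘ suc) I ∙ (if b then gs zero else ε)

  subproduct-cong : {gs hs : Fin r → Fin n} → gs ≗ hs → ∀ I → subproduct gs I ≡ subproduct hs I
  subproduct-cong gs≗hs []          = refl
  subproduct-cong gs≗hs (true ∷ I)  = cong₂ _∙_ (subproduct-cong (gs≗hs ∘ suc) I) (gs≗hs zero)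
  subproduct-cong gs≗hs (false ∷ I) = cong (_∙ ε) (subproduct-cong (gs≗hs ∘ suc) I)

  homo-subproduct : ∀ {φ} → Homomorphic φ →
    (gs : Fin r → Fin n) → ∀ I → φ (subproduct gs I) ≡ subproduct (φ ∘ gs) I
  homo-subproduct φ-homo gs []      = homo-ε φ-homo
  homo-subproduct {φ = φ} φ-homo gs (b ∷ I) = trans (φ-homo _ _)
    (cong₂ _∙_ (homo-subproduct φ-homo (gs ∘ suc) I) (homo-if b))
    where
    homo-if : ∀ b → φ (if b then gs zero else ε) ≡ (if b then φ (gs zero) else ε)
    homo-if true  = refl
    homo-if false = homo-ε φ-homo

  IsSubproductQuotient : (Fin r → Fin n) → Pred (Fin n) 0ℓ
  IsSubproductQuotient gs z = ∃₂ λ I J → z ≡ subproduct gs I \\ subproduct gs J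

  isSubproductQuotient? : (gs : Fin r → Fin n) → Decidable (IsSubproductQuotient gs)
  isSubproductQuotient? gs z =
    anySubset? λ I → anySubset? λ J → z Finₚ.≟ subproduct gs I \\ subproduct gs J

  subproduct-injective-∷ : {gs : Fin r → Fin n} {g : Fin n} → Injective _≡_ _≡_ (subproduct gs) →
    ¬ IsSubproductQuotient gs g → Injective _≡_ _≡_ (subproduct (g Vector.∷ gs))
  subproduct-injective-∷ {g = g} inj new {true ∷ I}  {true ∷ J}  eq =
    cong (true ∷_) (inj (∙-cancelʳ g _ _ eq))
  subproduct-injective-∷         inj new {false ∷ I} {false ∷ J} eq =
    cong (false ∷_) (inj (∙-cancelʳ ε _ _ eq))
  subproduct-injective-∷         inj new {true ∷ I}  {false ∷ J} eq =
    contradiction (I , J , y≈x\\z _ _ _ (trans eq (identityʳ _))) new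
  subproduct-injective-∷         inj new {false ∷ I} {true ∷ J}  eq =
    contradiction (J , I , y≈x\\z _ _ _ (trans (sym eq) (identityʳ _))) new

  2^r≤n : {gs : Fin r → Fin n} → Injective _≡_ _≡_ (subproduct gs) → 2 ^ r ≤ n
  2^r≤n {gs = gs} inj =
    Finₚ.injective⇒≤ {f = subproduct gs ∘ finToSubset} (finToSubset-injective ∘ inj)

  module _ {ψ : Fin n → Fin n} (ψ-homo : Homomorphic ψ) where
    open LocalMinima ψ

    count-fixed+count-fixed≤n : ∀ {g} → ψ g ≢ g → count fixed? + count fixed? ≤ n
    count-fixed+count-fixed≤n {g} ψg≢g =
      count+count≤n fixed? fixed? (∙-cancelˡ g _ _) g∙fixed-unfixed
      where
      g∙fixed-unfixed : ∀ {x} → Fixed x → ¬ Fixed (g ∙ x)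
      g∙fixed-unfixed {x} ψx≡x ψ[g∙x]≡g∙x = ψg≢g (∙-cancelʳ x _ _ (begin
        ψ g ∙ x     ≡⟨ cong (ψ g ∙_) ψx≡x ⟨
        ψ g ∙ ψ x   ≡⟨ ψ-homo g x ⟨
        ψ (g ∙ x)   ≡⟨ ψ[g∙x]≡g∙x ⟩
        g ∙ x       ∎))
        where open ≡-Reasoning

    count-localMinima*4≤3n : Injective _≡_ _≡_ ψ → ∃ (λ g → ψ g ≢ g) →
      count localMinimum? * 4 ≤ 3 * n
    count-localMinima*4≤3n ψ-injective (_ , ψg≢g) = b+a≤n⇒a≤b+c⇒c+c≤n⇒a*4≤3n
      (count-unfixedLocalMinima+count-localMinima≤n ψ-injective)
      count-localMinima≤unfixed+fixed
      (count-fixed+count-fixed≤n ψg≢g)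

  record SubproductBasis : Set where
    field
      rank             : ℕ
      generator        : Fin rank → Fin n
      2^rank≤n         : 2 ^ rank ≤ n
      quotients-cover  : ∀ z → IsSubproductQuotient generator z

  -- Greedily adjoin an element that is not yet a quotient of subproducts: the
  -- subproducts stay pairwise distinct, so at most log₂ n elements are adjoined.
  subproductBasis : SubproductBasis
  subproductBasis = grow {0} n (λ ()) (λ { {[]} {[]} _ → refl }) (ℕₚ.m≤m+n n 0)
    where
    grow : (fuel : ℕ) (gs : Fin r → Fin n) → Injective _≡_ _≡_ (subproduct gs) →
           n ≤ fuel + r → SubproductBasis
    grow fuel gs inj n≤fuel+r with Finₚ.all? (isSubproductQuotient? gs)
    ... | yes covers = record
      { rank = _ ; generator = gs ; 2^rank≤n = 2^r≤n inj ; quotients-cover = covers }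
    ... | no ¬covers with Finₚ.¬∀⟶∃¬ n _ (isSubproductQuotient? gs) ¬covers
    grow {r} zero gs inj n≤r | no _ | g , new = contradiction
      (ℕₚ.≤-trans (2^r≤n (subproduct-injective-∷ inj new)) n≤r)
      (ℕₚ.<⇒≱ (ℕₚ.<-trans (ℕₚ.n<1+n r) (n<2^n (suc r))))
    grow {r} (suc fuel) gs inj n≤fuel+r | no _ | g , new =
      grow fuel (g Vector.∷ gs) (subproduct-injective-∷ inj new)
        (ℕₚ.≤-trans n≤fuel+r (ℕₚ.≤-reflexive (sym (ℕₚ.+-suc fuel r))))

  module _ (basis : SubproductBasis) where

    open SubproductBasis basis

    decode : Fin (n ^ rank) → Fin n → Fin n
    decode c z = let (I , J , _) = quotients-cover z; t = finToFun c in
      subproduct t I \\ subproduct t J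

    decode-funToFin : ∀ {φ} → Homomorphic φ → decode (funToFin (φ ∘ generator)) ≗ φ
    decode-funToFin {φ} φ-homo z =
      let (I , J , z≡I\\J) = quotients-cover z
          t≗φ∘generator = Finₚ.finToFun-funToFin (φ ∘ generator)
      in begin
        subproduct (finToFun (funToFin (φ ∘ generator))) I \\
        subproduct (finToFun (funToFin (φ ∘ generator))) J
          ≡⟨ cong₂ _\\_ (subproduct-cong t≗φ∘generator I) (subproduct-cong t≗φ∘generator J) ⟩
        subproduct (φ ∘ generator) I \\ subproduct (φ ∘ generator) J
          ≡⟨ cong₂ _\\_ (homo-subproduct φ-homo generator I) (homo-subproduct φ-homo generator J) ⟨
        φ (subproduct generator I) \\ φ (subproduct generator J)
          ≡⟨ homo-\\ φ-homo _ _ ⟨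
        φ (subproduct generator I \\ subproduct generator J)
          ≡⟨ cong φ z≡I\\J ⟨
        φ z ∎
      where open ≡-Reasoning

    CodedBy : Subset n → Fin (n ^ rank) → Set
    CodedBy S c = let open LocalMinima (decode c) in
      Invariant (lookup S) × count localMinimum? * 4 ≤ 3 * n

    encode : (S : Subset n) (c : Fin (n ^ rank)) → CodedBy S c → Fin (n ^ rank * 2 ^ (3 * n / 4))
    encode S c (_ , bound) = combine c (inject≤ (subsetToFin (restrictToLocalMinima S))
      (ℕₚ.^-monoʳ-≤ 2 count≤3n/4))
      where
      open LocalMinima (decode c)
      count≤3n/4 : count localMinimum? ≤ 3 * n / 4
      count≤3n/4 = subst (_≤ 3 * n / 4) (m*n/n≡m (count localMinimum?) 4) (/-monoˡ-≤ 4 bound)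

    encode-injective : ∀ {S S′ c c′} (p : CodedBy S c) (p′ : CodedBy S′ c′) →
      encode S c p ≡ encode S′ c′ p′ → S ≡ S′
    encode-injective {c = c} {c′} (S-inv , _) (S′-inv , _) eq
      with refl , digits-eq ← Finₚ.combine-injective c _ c′ _ eq =
      restrictToLocalMinima-injective S-inv S′-inv
        (subsetToFin-injective (Finₚ.inject≤-injective _ _ _ _ digits-eq))
      where open LocalMinima (decode c)

    fixedByNontrivialAut⇒coded : ∀ {S} → FixedByNontrivialAut G S → ∃ (CodedBy S)
    fixedByNontrivialAut⇒coded {S} (φ , φ-aut , φ≢id , image) =
      funToFin (φ ∘ generator) , S-invariant , count-localMinima*4≤3n ψ-homo ψ-injective ψ-moves
      where
      open IsAutomorphism φ-aut using (homo; bijective)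

      ψ : Fin n → Fin n
      ψ = decode (funToFin (φ ∘ generator))

      ψ≗φ : ψ ≗ φ
      ψ≗φ = decode-funToFin homo

      ψ-homo : Homomorphic ψ
      ψ-homo x y = begin
        ψ (x ∙ y)  ≡⟨ ψ≗φ (x ∙ y) ⟩
        φ (x ∙ y)  ≡⟨ homo x y ⟩
        φ x ∙ φ y  ≡⟨ cong₂ _∙_ (ψ≗φ x) (ψ≗φ y) ⟨
        ψ x ∙ ψ y  ∎
        where open ≡-Reasoning

      ψ-injective : Injective _≡_ _≡_ ψ
      ψ-injective eq = proj₁ bijective (trans (sym (ψ≗φ _)) (trans eq (ψ≗φ _)))

      ψ-moves : ∃ λ g → ψ g ≢ g
      ψ-moves = Product.map₂ (λ φg≢g → φg≢g ∘ trans (sym (ψ≗φ _)))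
        (Finₚ.¬∀⟶∃¬ n _ (λ x → φ x Finₚ.≟ x) φ≢id)

      S-invariant : LocalMinima.Invariant ψ (lookup S)
      S-invariant x =
        trans (cong (lookup S) (ψ≗φ x)) (imageEq⇒lookup-invariant (proj₁ bijective) image x)

    count-fixedByNontrivialAut : (f : Fin k → Subset n) → Injective _≡_ _≡_ f →
      (∀ i → FixedByNontrivialAut G (f i)) → k ≤ n ^ rank * 2 ^ (3 * n / 4)
    count-fixedByNontrivialAut {k = k} f f-injective fixed = Finₚ.injective⇒≤ {f = code}
      (λ {i} {j} → f-injective ∘ encode-injective (proj₂ (coded i)) (proj₂ (coded j)))
      where
      coded : ∀ i → ∃ (CodedBy (f i))
      coded = fixedByNontrivialAut⇒coded ∘ fixed

      code : Fin k → Fin (n ^ rank * 2 ^ (3 * n / 4))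
      code i = encode (f i) (proj₁ (coded i)) (proj₂ (coded i))

lemma5p2 : (n : ℕ) (G : FinGroup n) (k : ℕ) (f : Fin k → Subset n) →
    Injective _≡_ _≡_ f → (∀ i → FixedByNontrivialAut G (f i)) → BoundedBy n k
lemma5p2 n G k f f-injective fixed =
  ≤n^r*2^c⇒BoundedBy {r = rank} {c = 3 * n / 4}
    (count-fixedByNontrivialAut subproductBasis f f-injective fixed) (m/n*n≤m (3 * n) 4) 2^rank≤n
  where
  open FiniteGroup G
  open SubproductBasis subproductBasis
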